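{- Let $p,q$ be primes with $2<p<q$ and $\kappa+\lambda\le p-\lambda$. If the pair $(p,q)$ is of Type II then $g=g_1$; if it is of Type I then $g<g_1$.
   Context: Let $p,q$ be primes with $2<p<q$, and put $p'=(p-1)/2$, $q'=(q-1)/2$. Set $d_0=pq$, $d_1=p'q$, $d_2=pq'$, $d_3=(pq-1)/2$, and for integers $x,y,z,w$ put $f(x,y,z,w)=xd_0+yd_1+zd_2+wd_3$. A positive integer is representable if it equals $f(x,y,z,w)$ for some nonnegative integers $x,y,z,w$; the Frobenius number $g$ is the largest positive integer that is not representable. Define integers $\kappa,\lambda,\kappa',\lambda'$ by $q=\kappa p+\lambda$ with $1\le\lambda\le p-1$ and $q'=\kappa'p'+\lambda'$ with $0\le\lambda'\le p'-1$. Put $g_0=f(p'-1,p-1,\kappa,-1)$ and $g_1=g_0-\lambda d_3$. When $\kappa+\lambda<p$ one has $\lambda\le p-3$ and $\lambda'\ge1$, and $\tau=\lfloor \lambda/(p-\lambda)\rfloor$ is the unique integer with $0\le\tau<\lambda$ and $\frac{\tau+2}{\tau+1}<\frac{p}{\lambda}<\frac{\tau+1}{\tau}$ (the right-hand inequality being vacuous when $\tau=0$). Such a pair is of Type I if $\frac{\tau+2}{\tau+1}<\frac{p'}{\lambda'}$ and of Type II if $\frac{p'}{\lambda'}\le\frac{\tau+2}{\tau+1}$. -}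

module Defs where

open import Data.Nat using (ℕ; zero; suc; _+_; _*_; _∸_; _≤_; _<_; ⌊_/2⌋)
open import Data.Integer as ℤ using (ℤ; +_)
open import Data.Product using (∃; ∃-syntax; _×_)
open import Relation.Nullary using (¬_)
open import Relation.Binary.PropositionalEquality using (_≡_)

-- p' = (p-1)/2 (p odd, so this is exact)
half-pred : ℕ → ℕ
half-pred n = ⌊ n ∸ 1 /2⌋

d₀ d₁ d₂ d₃ : ℕ → ℕ → ℕ
d₀ p q = p * q
d₁ p q = half-pred p * q
d₂ p q = p * half-pred q
d₃ p q = ⌊ p * q ∸ 1 /2⌋

f : ℕ → ℕ → ℤ → ℤ → ℤ → ℤ → ℤ
f p q x y z w =
  x ℤ.* + d₀ p q ℤ.+ y ℤ.* + d₁ p q ℤ.+ z ℤ.* + d₂ p q ℤ.+ w ℤ.* + d₃ p q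

Representable : ℕ → ℕ → ℕ → Set
Representable p q n =
  ∃[ x ] ∃[ y ] ∃[ z ] ∃[ w ] (n ≡ x * d₀ p q + y * d₁ p q + z * d₂ p q + w * d₃ p q)

IsFrobeniusNumber : ℕ → ℕ → ℕ → Set
IsFrobeniusNumber p q g =
  0 < g × ¬ Representable p q g × (∀ n → g < n → Representable p q n)

g₀ : ℕ → ℕ → ℕ → ℤ
g₀ p q κ = f p q (+ (half-pred p ∸ 1)) (+ (p ∸ 1)) (+ κ) (ℤ.- (+ 1))

g₁ : ℕ → ℕ → ℕ → ℕ → ℤ
g₁ p q κ λ′ = g₀ p q κ ℤ.- (+ λ′) ℤ.* (+ d₃ p q)

-- Type I:  (τ+2)/(τ+1) < p'/λ'   (cross-multiplied, denominators positive)
TypeI : ℕ → ℕ → ℕ → Set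
TypeI p λ' τ = (τ + 2) * λ' < half-pred p * (τ + 1)

-- Type II: p'/λ' ≤ (τ+2)/(τ+1)
TypeII : ℕ → ℕ → ℕ → Set
TypeII p λ' τ = half-pred p * (τ + 1) ≤ (τ + 2) * λ'

-- Write p = 2P + 1 and q = 2Q + 1. As 2d₁ = pq − q, 2d₂ = pq − p and
-- 2d₃ = pq − 1, n is representable iff 2n + (yq + zp + w) = s·pq for some
-- y, z, w whose cost y + z + w is at most s and has the parity of s.
-- Under κ + 2l ≤ p one has τ = 0 and κ + l = 2λ′ + 1, so Type II means
-- p′ < κ + l and Type I means κ + l ≤ p′. With S₀ = 2p + κ − l − 6,
-- g₁ is the natural number g with 2g = S₀·pq + 2l + 1.
-- Every r < pq splits as yq + zp + w with cost at most S₀ + 3, and at most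
-- S₀ + 2 when r ≤ pq − 2l − 3; taking r ≡ −2n mod pq shows that every
-- n > g is representable.  In Type II every splitting of s·pq − 2g costs
-- more than s: after removing whole multiples of p, q and pq only
-- s ∈ {S₀ + 1, S₀ + 2} remain, and these are checked using p < 2(κ + l);
-- so g is the Frobenius number.  In Type I,
-- g = (p′ − κ − l)d₀ + (p − 3)d₁ + 3κd₂ + (l − 1)d₃ is itself representable,
-- so the Frobenius number is smaller.

{-# OPTIONS --safe #-}
module Submission where

open import Defs
open import Data.Nat
open import Data.Nat.Properties
open import Data.Nat.DivMod using (_/_; _%_; m≡m%n+[m/n]*n; m%n<n; [m+kn]%n≡m%n; m<n⇒m%n≡m; n%n≡0)
open import Data.Nat.Primality using (Prime)
open import Data.Nat.Divisibility using (divides)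
open import Data.Nat.Divisibility.Core using (hasNonTrivialDivisor)
open import Data.Nat.Tactic.RingSolver using (solve; solve-∀)
open import Data.List.Base using (_∷_; [])
open import Data.Integer as ℤ using (ℤ; +_)
import Data.Integer.Properties as ℤ
import Data.Integer.Tactic.RingSolver as ℤ-Solver
open import Data.Product
open import Data.Sum using (_⊎_; inj₁; inj₂)
open import Function using (_⇔_; mk⇔; Equivalence)
open import Relation.Nullary using (¬_; Dec; yes; no; contradiction)
open import Relation.Nullary.Decidable using (map′)
open import Relation.Unary using (Decidable)
open import Relation.Binary.PropositionalEquality

-- Odd moduli and doubled representations

even⊎odd : ∀ n → ∃ λ k → n ≡ k + k ⊎ n ≡ suc (k + k)
even⊎odd zero = 0 , inj₁ refl
even⊎odd (suc n) with even⊎odd n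
... | k , inj₁ refl = k , inj₂ refl
... | k , inj₂ refl = suc k , inj₁ (cong suc (sym (+-suc k k)))

odd-prime : ∀ {p} → Prime p → 2 < p → ∃ λ P → p ≡ suc (P + P)
odd-prime {p} pp 2<p with even⊎odd p
... | P , inj₂ p≡odd = P , p≡odd
... | k , inj₁ p≡even = contradiction
  (hasNonTrivialDivisor {divisor = 2} 2<p (divides k (trans p≡even (solve (k ∷ [])))))
  (Prime.notComposite pp)

double-injective : ∀ {m n} → m + m ≡ n + n → m ≡ n
double-injective {m} {n} eq = begin
  m             ≡⟨ n≡⌊n+n/2⌋ m ⟩
  ⌊ m + m /2⌋   ≡⟨ cong ⌊_/2⌋ eq ⟩
  ⌊ n + n /2⌋   ≡⟨ n≡⌊n+n/2⌋ n ⟨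
  n             ∎
  where open ≡-Reasoning

double-cancel-≤ : ∀ {m n} → m + m ≤ n + n → m ≤ n
double-cancel-≤ {m} {n} le = begin
  m             ≡⟨ n≡⌊n+n/2⌋ m ⟩
  ⌊ m + m /2⌋   ≤⟨ ⌊n/2⌋-mono le ⟩
  ⌊ n + n /2⌋   ≡⟨ n≡⌊n+n/2⌋ n ⟨
  n             ∎
  where open ≤-Reasoning

half-pred-odd : ∀ P → half-pred (suc (P + P)) ≡ P
half-pred-odd P = sym (n≡⌊n+n/2⌋ P)

d₃-odd : ∀ P Q → d₃ (suc (P + P)) (suc (Q + Q)) ≡ P * Q + P * Q + P + Q
d₃-odd P Q = begin
  ⌊ Q + Q + (P + P) * suc (Q + Q) /2⌋                    ≡⟨ cong ⌊_/2⌋ (solve (P ∷ Q ∷ [])) ⟩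
  ⌊ (P * Q + P * Q + P + Q) + (P * Q + P * Q + P + Q) /2⌋ ≡⟨ n≡⌊n+n/2⌋ _ ⟨
  P * Q + P * Q + P + Q                                  ∎
  where open ≡-Reasoning

even-part : ∀ d i j → d + (j + j) ≡ i + i → ∃ λ x → d ≡ x + x
even-part d i       zero    eq = i , trans (sym (+-identityʳ d)) eq
even-part d zero    (suc j) eq = contradiction (trans (sym (+-suc d (j + suc j))) eq) λ ()
even-part d (suc i) (suc j) eq = even-part d i j (suc-injective (suc-injective (begin
  2 + (d + (j + j))      ≡⟨ solve (d ∷ j ∷ []) ⟩
  d + (suc j + suc j)    ≡⟨ eq ⟩
  suc i + suc i          ≡⟨ cong suc (+-suc i i) ⟩
  2 + (i + i)            ∎)))
  where open ≡-Reasoning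

same-parity-≤ : ∀ {c a} i j → c + (i + i) ≡ a + (j + j) → c ≤ suc a → ∃ λ x → c + (x + x) ≡ a
same-parity-≤ {c} {a} i j eq c≤1+a with m≤n⇒m<n∨m≡n c≤1+a
... | inj₂ refl = contradiction (begin
  2 * j          ≡⟨ solve (j ∷ []) ⟩
  j + j          ≡⟨ +-cancelˡ-≡ a _ _ (trans (+-suc a (i + i)) eq) ⟨
  suc (i + i)    ≡⟨ cong suc (solve (i ∷ [])) ⟩
  suc (2 * i)    ∎) (even≢odd j i)
  where open ≡-Reasoning
... | inj₁ c<1+a with m≤n⇒∃[o]m+o≡n (≤-pred c<1+a)
...   | d , refl with even-part d i j (+-cancelˡ-≡ c _ _ (trans (sym (+-assoc c d (j + j))) (sym eq)))
...     | x , refl = x , refl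

DoublyRepresentable : ℕ → ℕ → ℕ → Set
DoublyRepresentable p q n =
  ∃[ x ] ∃[ y ] ∃[ z ] ∃[ w ] n + n + (y * q + z * p + w) ≡ (x + x + y + z + w) * (p * q)

module _ (P Q : ℕ) where
  private
    p = suc (P + P)
    q = suc (Q + Q)

    combination : ℕ → ℕ → ℕ → ℕ → ℕ
    combination x y z w = x * d₀ p q + y * d₁ p q + z * d₂ p q + w * d₃ p q

    combination-doubled : ∀ x y z w →
      combination x y z w + combination x y z w + (y * q + z * p + w) ≡ (x + x + y + z + w) * (p * q)
    combination-doubled x y z w rewrite half-pred-odd P | half-pred-odd Q | d₃-odd P Q =
      solve (P ∷ Q ∷ x ∷ y ∷ z ∷ w ∷ [])

  representable⇔doubly : ∀ n → Representable p q n ⇔ DoublyRepresentable p q n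
  representable⇔doubly n = mk⇔ to from
    where
    to : Representable p q n → DoublyRepresentable p q n
    to (x , y , z , w , refl) = x , y , z , w , combination-doubled x y z w
    from : DoublyRepresentable p q n → Representable p q n
    from (x , y , z , w , eq) = x , y , z , w ,
      double-injective (+-cancelʳ-≡ (y * q + z * p + w) _ _ (trans eq (sym (combination-doubled x y z w))))

  -- Modulo 2 the equation says y + z + w ≡ a, as p, q and pq are odd.
  cost≤⇒doubly : ∀ n a y z w → n + n + (y * q + z * p + w) ≡ a * (p * q) → y + z + w ≤ suc a →
                 DoublyRepresentable p q n
  cost≤⇒doubly n a y z w eq cost≤ with same-parity-≤ (n + y * Q + z * P) (a * (P + Q + 2 * P * Q)) mod2 cost≤
    where
    mod2 : (y + z + w) + ((n + y * Q + z * P) + (n + y * Q + z * P)) ≡ a + (a * (P + Q + 2 * P * Q) + a * (P + Q + 2 * P * Q))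
    mod2 = begin
      (y + z + w) + ((n + y * Q + z * P) + (n + y * Q + z * P))  ≡⟨ solve (n ∷ y ∷ z ∷ w ∷ P ∷ Q ∷ []) ⟩
      n + n + (y * suc (Q + Q) + z * suc (P + P) + w)            ≡⟨ eq ⟩
      a * (suc (P + P) * suc (Q + Q))                            ≡⟨ solve (a ∷ P ∷ Q ∷ []) ⟩
      a + (a * (P + Q + 2 * P * Q) + a * (P + Q + 2 * P * Q))    ∎
      where open ≡-Reasoning
  ... | x , refl = x , y , z , w , trans eq (cong (_* (p * q)) reorder)
    where
    reorder : y + z + w + (x + x) ≡ x + x + y + z + w
    reorder = solve (x ∷ y ∷ z ∷ w ∷ [])

-- Existence of the Frobenius number

bounded-∃? : {A : ℕ → Set} → Decidable A → ∀ n → (∀ k → A k → k ≤ n) → Dec (∃ A)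
bounded-∃? A? n bound =
  map′ (λ (k , _ , a) → k , a) (λ (k , a) → k , s≤s (bound k a) , a) (anyUpTo? A? (suc n))

module _ (p q : ℕ) (2≤d₀ : 2 ≤ d₀ p q) (2≤d₁ : 2 ≤ d₁ p q) (2≤d₂ : 2 ≤ d₂ p q) (2≤d₃ : 2 ≤ d₃ p q) where
  private
    terms≤ : ∀ {n} x y z w → n ≡ x * d₀ p q + y * d₁ p q + z * d₂ p q + w * d₃ p q →
             x * d₀ p q ≤ n × y * d₁ p q ≤ n × z * d₂ p q ≤ n × w * d₃ p q ≤ n
    terms≤ x y z w refl =
      ≤-trans (≤-trans (m≤m+n a b) (m≤m+n (a + b) c)) (m≤m+n (a + b + c) d) ,
      ≤-trans (≤-trans (m≤n+m b a) (m≤m+n (a + b) c)) (m≤m+n (a + b + c) d) ,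
      ≤-trans (m≤n+m c (a + b)) (m≤m+n (a + b + c) d) ,
      m≤n+m d (a + b + c)
      where
      a = x * d₀ p q
      b = y * d₁ p q
      c = z * d₂ p q
      d = w * d₃ p q

    coefficient≤ : ∀ {k a n} → 2 ≤ a → k * a ≤ n → k ≤ n
    coefficient≤ {k} {suc a} _ ka≤n = ≤-trans (m≤m*n k (suc a)) ka≤n

    multiple≤1 : ∀ {k a} → 2 ≤ a → k * a ≤ 1 → k * a ≡ 0
    multiple≤1 {zero}  _    _  = refl
    multiple≤1 {suc k} 2≤a ka≤1 = contradiction (≤-trans 2≤a (≤-trans (m≤m+n _ (k * _)) ka≤1)) λ { (s≤s ()) }

  representable? : ∀ n → Dec (Representable p q n)
  representable? n =
    bounded-∃? (λ x →
      bounded-∃? (λ y →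
        bounded-∃? (λ z →
          bounded-∃? (λ w → n ≟ x * d₀ p q + y * d₁ p q + z * d₂ p q + w * d₃ p q)
            n (λ w eq → coefficient≤ 2≤d₃ (proj₂ (proj₂ (proj₂ (terms≤ x y z w eq))))))
          n (λ z (w , eq) → coefficient≤ 2≤d₂ (proj₁ (proj₂ (proj₂ (terms≤ x y z w eq))))))
        n (λ y (z , w , eq) → coefficient≤ 2≤d₁ (proj₁ (proj₂ (terms≤ x y z w eq)))))
      n (λ x (y , z , w , eq) → coefficient≤ 2≤d₀ (proj₁ (terms≤ x y z w eq)))

  1-not-representable : ¬ Representable p q 1
  1-not-representable (x , y , z , w , eq) with terms≤ x y z w eq
  ... | t₀ , t₁ , t₂ , t₃
    rewrite multiple≤1 {x} 2≤d₀ t₀ | multiple≤1 {y} 2≤d₁ t₁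
          | multiple≤1 {z} 2≤d₂ t₂ | multiple≤1 {w} 2≤d₃ t₃ = contradiction eq λ ()

greatest-non-member : {R : ℕ → Set} → Decidable R → ¬ R 1 → ∀ G → (∀ n → G ≤ n → R n) →
                      ∃ λ g → 0 < g × ¬ R g × (∀ n → g < n → R n) × g < G
greatest-non-member R? ¬R1 zero    R≥ = contradiction (R≥ 1 z≤n) ¬R1
greatest-non-member {R = R} R? ¬R1 (suc G) R> with R? G
... | no ¬RG = G , positive G R> , ¬RG , R> , ≤-refl
  where
  positive : ∀ G → (∀ n → suc G ≤ n → R n) → 0 < G
  positive zero    R> = contradiction (R> 1 ≤-refl) ¬R1
  positive (suc _) _  = s≤s z≤n
... | yes RG with greatest-non-member R? ¬R1 G R≥
  where
  R≥ : ∀ n → G ≤ n → R n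
  R≥ n G≤n with m≤n⇒m<n∨m≡n G≤n
  ... | inj₁ G<n  = R> n G<n
  ... | inj₂ refl = RG
...   | g , 0<g , ¬Rg , R>g , g<G = g , 0<g , ¬Rg , R>g , m<n⇒m<1+n g<G

-- Splittings of remainders and their cost

+-mono-≤₃ : ∀ {a b c x y z} → a ≤ x → b ≤ y → c ≤ z → a + b + c ≤ x + y + z
+-mono-≤₃ a≤x b≤y c≤z = +-mono-≤ (+-mono-≤ a≤x b≤y) c≤z

*-cancelʳ-<-+ : ∀ p a b c → a * p + suc b ≤ c * p → a < c
*-cancelʳ-<-+ p a b c le = *-cancelʳ-< p a c (<-≤-trans (m<m+n (a * p) (s≤s z≤n)) le)

round-up : ∀ N → 0 < N → ∀ m → ∃₂ λ a r → m + r ≡ a * N × r < N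
round-up N 0<N zero = 0 , 0 , refl , 0<N
round-up N 0<N (suc m) with round-up N 0<N m
... | a , suc r , m+1+r≡aN , 1+r<N = a , r , trans (sym (+-suc m r)) m+1+r≡aN , <-trans (n<1+n r) 1+r<N
... | a , zero  , m+0≡aN   , _     with N
...   | suc N-1 = suc a , N-1 , m+1+N-1≡[1+a]N , ≤-refl
  where
  open ≡-Reasoning
  m+1+N-1≡[1+a]N : suc m + N-1 ≡ suc a * suc N-1
  m+1+N-1≡[1+a]N = begin
    suc m + N-1           ≡⟨ +-suc m N-1 ⟨
    m + suc N-1           ≡⟨ cong (_+ suc N-1) (trans (sym (+-identityʳ m)) m+0≡aN) ⟩
    a * suc N-1 + suc N-1 ≡⟨ +-comm (a * suc N-1) (suc N-1) ⟩
    suc a * suc N-1       ∎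

module Budget (p q κ l : ℕ) (q≡κp+l : q ≡ κ * p + l)
              (1≤κ : 1 ≤ κ) (1≤l : 1 ≤ l) (κ+2l≤p : κ + l + l ≤ p)
              (S₀ : ℕ) (S₀+l+6≡budget : S₀ + l + 6 ≡ p + p + κ) where

  -- As S₀ + l + 6 = p + p + κ, the bounds say cost ≤ S₀ + 3, and cost ≤ S₀ + 2 for small r.
  record CheapSplitting (r : ℕ) : Set where
    field
      y z w   : ℕ
      splits  : y * q + z * p + w ≡ r
      cost≤   : y + z + w + l + 3 ≤ p + p + κ
      cost<   : r + l + l + 3 ≤ p * q → y + z + w + l + 4 ≤ p + p + κ

  2l<p : l + l < p
  2l<p = begin
    1 + (l + l) ≤⟨ +-monoˡ-≤ (l + l) 1≤κ ⟩
    κ + (l + l) ≡⟨ +-assoc κ l l ⟨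
    κ + l + l   ≤⟨ κ+2l≤p ⟩
    p           ∎
    where open ≤-Reasoning

  private instance
    κ-nonZero : NonZero κ
    κ-nonZero = >-nonZero 1≤κ
    p-nonZero : NonZero p
    p-nonZero = >-nonZero (<-≤-trans (s≤s z≤n) 2l<p)
    q-nonZero : NonZero q
    q-nonZero = >-nonZero (≤-trans 1≤l (≤-trans (m≤n+m l (κ * p)) (≤-reflexive (sym q≡κp+l))))
    pq-nonZero : NonZero (p * q)
    pq-nonZero = m*n≢0 p q
    κ+l-nonZero : NonZero (κ + l)
    κ+l-nonZero = >-nonZero (≤-trans 1≤κ (m≤m+n κ l))

  l+2≤p : l + 2 ≤ p
  l+2≤p = begin
    l + 2         ≡⟨ +-comm l 2 ⟩
    suc (1 + l)   ≡⟨ cong suc (+-comm 1 l) ⟩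
    suc (l + 1)   ≤⟨ s≤s (+-monoʳ-≤ l 1≤l) ⟩
    suc (l + l)   ≤⟨ 2l<p ⟩
    p             ∎
    where open ≤-Reasoning

  last-row : ∀ Y e ρ → suc Y ≡ p → Y * q + e * p + ρ + l + l + 3 ≤ p * q → e * p + (3 + ρ + l) ≤ κ * p
  last-row Y e ρ 1+Y≡p small = +-cancelˡ-≤ (Y * q + l) _ _ (begin
    Y * q + l + (e * p + (3 + ρ + l)) ≡⟨ solve (Y ∷ q ∷ l ∷ e ∷ p ∷ ρ ∷ []) ⟩
    Y * q + e * p + ρ + l + l + 3   ≤⟨ small ⟩
    p * q                           ≡⟨ cong (_* q) (sym 1+Y≡p) ⟩
    q + Y * q                       ≡⟨ cong (_+ Y * q) q≡κp+l ⟩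
    κ * p + l + Y * q               ≡⟨ solve (κ ∷ p ∷ l ∷ Y ∷ q ∷ []) ⟩
    Y * q + l + κ * p               ∎)
    where open ≤-Reasoning

  last-row-below-top : ∀ Y e ρ → suc Y ≡ p → suc e ≡ κ → Y * q + e * p + ρ + l + l + 3 ≤ p * q → 3 + ρ + l ≤ p
  last-row-below-top Y e ρ 1+Y≡p refl small =
    +-cancelˡ-≤ (e * p) _ _ (≤-trans (last-row Y e ρ 1+Y≡p small) (≤-reflexive (+-comm p (e * p))))

  cheap-top : ∀ Y ρ → Y < p → κ * p + ρ < q → CheapSplitting (Y * q + κ * p + ρ)
  cheap-top Y ρ Y<p κp+ρ<q = record { y = Y ; z = κ ; w = ρ ; splits = refl ; cost≤ = cost≤ ; cost< = cost< }
    where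
    open ≤-Reasoning
    ρ<l : ρ < l
    ρ<l = +-cancelˡ-< (κ * p) ρ l (<-≤-trans κp+ρ<q (≤-reflexive q≡κp+l))
    ρ+l+2≤p : ρ + l + 2 ≤ p
    ρ+l+2≤p = begin
      ρ + l + 2       ≡⟨ solve (ρ ∷ l ∷ []) ⟩
      suc (suc ρ + l) ≤⟨ s≤s (+-monoˡ-≤ l ρ<l) ⟩
      suc (l + l)     ≤⟨ 2l<p ⟩
      p               ∎
    cost≤ : Y + κ + ρ + l + 3 ≤ p + p + κ
    cost≤ = begin
      Y + κ + ρ + l + 3       ≡⟨ solve (Y ∷ κ ∷ ρ ∷ l ∷ []) ⟩
      suc Y + (ρ + l + 2) + κ ≤⟨ +-mono-≤₃ Y<p ρ+l+2≤p ≤-refl ⟩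
      p + p + κ               ∎
    cost< : Y * q + κ * p + ρ + l + l + 3 ≤ p * q → Y + κ + ρ + l + 4 ≤ p + p + κ
    cost< small with m≤n⇒m<n∨m≡n Y<p
    ... | inj₂ 1+Y≡p = contradiction (last-row Y κ ρ 1+Y≡p small) (m+1+n≰m (κ * p))
    ... | inj₁ 2+Y≤p = begin
      Y + κ + ρ + l + 4             ≡⟨ solve (Y ∷ κ ∷ ρ ∷ l ∷ []) ⟩
      suc (suc Y) + (ρ + l + 2) + κ ≤⟨ +-mono-≤₃ 2+Y≤p ρ+l+2≤p ≤-refl ⟩
      p + p + κ                     ∎

  cheap-no-carry : ∀ Y e ρ → Y < p → e < κ → ρ + l < p → CheapSplitting (Y * q + e * p + ρ)
  cheap-no-carry Y e ρ Y<p e<κ ρ+l<p = record { y = Y ; z = e ; w = ρ ; splits = refl ; cost≤ = cost≤ ; cost< = cost< }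
    where
    open ≤-Reasoning
    cost≤ : Y + e + ρ + l + 3 ≤ p + p + κ
    cost≤ = begin
      Y + e + ρ + l + 3             ≡⟨ solve (Y ∷ e ∷ ρ ∷ l ∷ []) ⟩
      suc Y + suc (ρ + l) + suc e   ≤⟨ +-mono-≤₃ Y<p ρ+l<p e<κ ⟩
      p + p + κ                     ∎
    cost< : Y * q + e * p + ρ + l + l + 3 ≤ p * q → Y + e + ρ + l + 4 ≤ p + p + κ
    cost< small with m≤n⇒m<n∨m≡n Y<p | m≤n⇒m<n∨m≡n e<κ
    ... | inj₁ 2+Y≤p | _ = begin
      Y + e + ρ + l + 4                   ≡⟨ solve (Y ∷ e ∷ ρ ∷ l ∷ []) ⟩
      suc (suc Y) + suc (ρ + l) + suc e   ≤⟨ +-mono-≤₃ 2+Y≤p ρ+l<p e<κ ⟩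
      p + p + κ                           ∎
    ... | inj₂ _ | inj₁ 2+e≤κ = begin
      Y + e + ρ + l + 4                   ≡⟨ solve (Y ∷ e ∷ ρ ∷ l ∷ []) ⟩
      suc Y + suc (ρ + l) + suc (suc e)   ≤⟨ +-mono-≤₃ Y<p ρ+l<p 2+e≤κ ⟩
      p + p + κ                           ∎
    ... | inj₂ 1+Y≡p | inj₂ 1+e≡κ = begin
      Y + e + ρ + l + 4                   ≤⟨ n≤1+n _ ⟩
      suc (Y + e + ρ + l + 4)             ≡⟨ solve (Y ∷ e ∷ ρ ∷ l ∷ []) ⟩
      suc Y + (3 + ρ + l) + suc e         ≤⟨ +-mono-≤₃ Y<p (last-row-below-top Y e ρ 1+Y≡p 1+e≡κ small) (≤-reflexive 1+e≡κ) ⟩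
      p + p + κ                           ∎

  -- The row carry Yq + ep + ρ = (Y − 1)q + (e + κ + 1)p + (ρ + l − p) trades
  -- one unit of y for the small remainder ρ + l − p < l.
  cheap-carry : ∀ Y e ρ w → Y < p → e < κ → ρ < p → p + w ≡ ρ + l → CheapSplitting (Y * q + e * p + ρ)
  cheap-carry zero e ρ _ _ e<κ ρ<p _ = record
    { y = 0 ; z = e ; w = ρ ; splits = refl
    ; cost≤ = ≤-trans (+-monoʳ-≤ (e + ρ + l) (n≤1+n 3)) cost ; cost< = λ _ → cost }
    where
    open ≤-Reasoning
    cost : e + ρ + l + 4 ≤ p + p + κ
    cost = begin
      e + ρ + l + 4             ≡⟨ solve (e ∷ ρ ∷ l ∷ []) ⟩
      suc ρ + (l + 2) + suc e   ≤⟨ +-mono-≤₃ ρ<p l+2≤p e<κ ⟩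
      p + p + κ                 ∎
  cheap-carry (suc Y) e ρ w 1+Y<p e<κ ρ<p p+w≡ρ+l = record
    { y = Y ; z = e + κ + 1 ; w = w ; splits = splits ; cost≤ = cost≤ ; cost< = cost< }
    where
    open ≤-Reasoning
    w<l : w < l
    w<l = +-cancelˡ-< p w l (begin-strict
      p + w ≡⟨ p+w≡ρ+l ⟩
      ρ + l <⟨ +-monoˡ-< l ρ<p ⟩
      p + l ∎)
    splits : Y * q + (e + κ + 1) * p + w ≡ suc Y * q + e * p + ρ
    splits = begin-equality
      Y * q + (e + κ + 1) * p + w       ≡⟨ solve (Y ∷ q ∷ e ∷ κ ∷ p ∷ w ∷ []) ⟩
      Y * q + e * p + κ * p + (p + w)   ≡⟨ cong (λ t → Y * q + e * p + κ * p + t) p+w≡ρ+l ⟩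
      Y * q + e * p + κ * p + (ρ + l)   ≡⟨ solve (Y ∷ q ∷ e ∷ κ ∷ p ∷ ρ ∷ l ∷ []) ⟩
      (κ * p + l) + Y * q + e * p + ρ   ≡⟨ cong (λ t → t + Y * q + e * p + ρ) q≡κp+l ⟨
      q + Y * q + e * p + ρ             ∎
    cost≤ : Y + (e + κ + 1) + w + l + 3 ≤ p + p + κ
    cost≤ = +-cancelʳ-≤ l _ _ (begin
      Y + (e + κ + 1) + w + l + 3 + l           ≡⟨ solve (Y ∷ e ∷ κ ∷ w ∷ l ∷ []) ⟩
      suc (suc Y) + suc e + suc w + (κ + l + l) ≤⟨ +-mono-≤ (+-mono-≤₃ 1+Y<p e<κ w<l) κ+2l≤p ⟩
      p + κ + l + p                             ≡⟨ solve (p ∷ κ ∷ l ∷ []) ⟩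
      p + p + κ + l                             ∎)
    cost< : suc Y * q + e * p + ρ + l + l + 3 ≤ p * q → Y + (e + κ + 1) + w + l + 4 ≤ p + p + κ
    cost< small with m≤n⇒m<n∨m≡n 1+Y<p | m≤n⇒m<n∨m≡n e<κ
    ... | inj₁ 3+Y≤p | _ = +-cancelʳ-≤ l _ _ (begin
      Y + (e + κ + 1) + w + l + 4 + l                 ≡⟨ solve (Y ∷ e ∷ κ ∷ w ∷ l ∷ []) ⟩
      suc (suc (suc Y)) + suc e + suc w + (κ + l + l) ≤⟨ +-mono-≤ (+-mono-≤₃ 3+Y≤p e<κ w<l) κ+2l≤p ⟩
      p + κ + l + p                                   ≡⟨ solve (p ∷ κ ∷ l ∷ []) ⟩
      p + p + κ + l                                   ∎)
    ... | inj₂ _ | inj₁ 2+e≤κ = +-cancelʳ-≤ l _ _ (begin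
      Y + (e + κ + 1) + w + l + 4 + l                 ≡⟨ solve (Y ∷ e ∷ κ ∷ w ∷ l ∷ []) ⟩
      suc (suc Y) + suc (suc e) + suc w + (κ + l + l) ≤⟨ +-mono-≤ (+-mono-≤₃ 1+Y<p 2+e≤κ w<l) κ+2l≤p ⟩
      p + κ + l + p                                   ≡⟨ solve (p ∷ κ ∷ l ∷ []) ⟩
      p + p + κ + l                                   ∎)
    ... | inj₂ 2+Y≡p | inj₂ 1+e≡κ = contradiction (begin-strict
      p          ≤⟨ m≤m+n p w ⟩
      p + w      ≡⟨ p+w≡ρ+l ⟩
      ρ + l      <⟨ m<n+m (ρ + l) {3} (s≤s z≤n) ⟩
      3 + ρ + l  ≤⟨ last-row-below-top (suc Y) e ρ 2+Y≡p 1+e≡κ small ⟩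
      p          ∎) (<-irrefl refl)

  cheap-splitting : ∀ r → r < p * q → CheapSplitting r
  cheap-splitting r r<pq = subst CheapSplitting (sym r≡Yq+ep+ρ) (by-cases (m≤n⇒m<n∨m≡n e≤κ))
    where
    open ≤-Reasoning
    Y = r / q
    e = (r % q) / p
    ρ = (r % q) % p
    ep+ρ≡r%q : e * p + ρ ≡ r % q
    ep+ρ≡r%q = trans (+-comm (e * p) ρ) (sym (m≡m%n+[m/n]*n (r % q) p))
    r≡Yq+ep+ρ : r ≡ Y * q + e * p + ρ
    r≡Yq+ep+ρ = begin-equality
      r                     ≡⟨ m≡m%n+[m/n]*n r q ⟩
      r % q + Y * q         ≡⟨ cong (_+ Y * q) ep+ρ≡r%q ⟨
      e * p + ρ + Y * q     ≡⟨ +-comm (e * p + ρ) (Y * q) ⟩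
      Y * q + (e * p + ρ)   ≡⟨ +-assoc (Y * q) (e * p) ρ ⟨
      Y * q + e * p + ρ     ∎
    Y<p : Y < p
    Y<p = *-cancelʳ-< q Y p (begin-strict
      Y * q          ≤⟨ m≤n+m (Y * q) (r % q) ⟩
      r % q + Y * q  ≡⟨ m≡m%n+[m/n]*n r q ⟨
      r              <⟨ r<pq ⟩
      p * q          ∎)
    ep+ρ<q : e * p + ρ < q
    ep+ρ<q = subst (_< q) (sym ep+ρ≡r%q) (m%n<n r q)
    e≤κ : e ≤ κ
    e≤κ = ≤-pred (*-cancelʳ-<-+ p e ρ (suc κ) (begin
      e * p + suc ρ   ≡⟨ +-suc (e * p) ρ ⟩
      suc (e * p + ρ) ≤⟨ ep+ρ<q ⟩
      q               ≡⟨ q≡κp+l ⟩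
      κ * p + l       ≤⟨ +-monoʳ-≤ (κ * p) (≤-trans (m≤m+n l l) (<⇒≤ 2l<p)) ⟩
      κ * p + p       ≡⟨ +-comm (κ * p) p ⟩
      suc κ * p       ∎))
    by-cases : e < κ ⊎ e ≡ κ → CheapSplitting (Y * q + e * p + ρ)
    by-cases (inj₂ e≡κ) = subst (λ t → CheapSplitting (Y * q + t * p + ρ)) (sym e≡κ)
      (cheap-top Y ρ Y<p (subst (λ t → t * p + ρ < q) e≡κ ep+ρ<q))
    by-cases (inj₁ e<κ) with ρ + l <? p
    ... | yes ρ+l<p = cheap-no-carry Y e ρ Y<p e<κ ρ+l<p
    ... | no  ρ+l≮p = let w , p+w≡ρ+l = m≤n⇒∃[o]m+o≡n (≮⇒≥ ρ+l≮p)
                      in cheap-carry Y e ρ w Y<p e<κ (m%n<n (r % q) p) p+w≡ρ+l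

  cheap-complement : ∀ m → S₀ * (p * q) + l + l + 3 ≤ m →
    ∃[ a ] ∃[ y ] ∃[ z ] ∃[ w ] m + (y * q + z * p + w) ≡ a * (p * q) × y + z + w ≤ suc a
  cheap-complement m threshold≤m with round-up (p * q) (>-nonZero⁻¹ (p * q)) m
  ... | a , r , m+r≡a·pq , r<pq =
    a , y , z , w , trans (cong (λ t → m + t) splits) m+r≡a·pq , cost≤1+a (m≤n⇒m<n∨m≡n S₀<a)
    where
    open ≤-Reasoning
    open CheapSplitting (cheap-splitting r r<pq)
    S₀<a : S₀ < a
    S₀<a = *-cancelʳ-< (p * q) S₀ a (begin-strict
      S₀ * (p * q)                <⟨ m<m+n (S₀ * (p * q)) (s≤s z≤n) ⟩
      S₀ * (p * q) + (3 + l + l)  ≡⟨ solve (S₀ ∷ p ∷ q ∷ l ∷ []) ⟩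
      S₀ * (p * q) + l + l + 3    ≤⟨ threshold≤m ⟩
      m                           ≤⟨ m≤m+n m r ⟩
      m + r                       ≡⟨ m+r≡a·pq ⟩
      a * (p * q)                 ∎)
    cost≤1+a : suc S₀ < a ⊎ suc S₀ ≡ a → y + z + w ≤ suc a
    cost≤1+a (inj₁ 2+S₀≤a) = +-cancelʳ-≤ (l + 3) _ _ (begin
      y + z + w + (l + 3)        ≡⟨ +-assoc (y + z + w) l 3 ⟨
      y + z + w + l + 3          ≤⟨ cost≤ ⟩
      p + p + κ                  ≡⟨ S₀+l+6≡budget ⟨
      S₀ + l + 6                 ≡⟨ solve (S₀ ∷ l ∷ []) ⟩
      3 + S₀ + (l + 3)           ≤⟨ +-monoˡ-≤ (l + 3) (s≤s 2+S₀≤a) ⟩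
      suc a + (l + 3)            ∎)
    cost≤1+a (inj₂ refl) = +-cancelʳ-≤ (l + 4) _ _ (begin
      y + z + w + (l + 4)        ≡⟨ +-assoc (y + z + w) l 4 ⟨
      y + z + w + l + 4          ≤⟨ cost< r-small ⟩
      p + p + κ                  ≡⟨ S₀+l+6≡budget ⟨
      S₀ + l + 6                 ≡⟨ solve (S₀ ∷ l ∷ []) ⟩
      suc (suc S₀) + (l + 4)     ∎)
      where
      r-small : r + l + l + 3 ≤ p * q
      r-small = +-cancelʳ-≤ (S₀ * (p * q)) _ _ (begin
        r + l + l + 3 + S₀ * (p * q)  ≡⟨ solve (r ∷ l ∷ S₀ ∷ p ∷ q ∷ []) ⟩
        S₀ * (p * q) + l + l + 3 + r  ≤⟨ +-monoˡ-≤ r threshold≤m ⟩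
        m + r                         ≡⟨ m+r≡a·pq ⟩
        p * q + S₀ * (p * q)          ∎)

  module LowerBound (p<2[κ+l] : p + 1 ≤ κ + κ + l + l) where

    2l≤p : l + l ≤ p
    2l≤p = <⇒≤ 2l<p

    rows-above : ∀ y z w j → l + l + 1 + (y * q + z * p + w) ≡ p * q → suc y + j ≡ p →
                 z * p + w + l + 1 ≡ suc j * κ * p + j * l
    rows-above y z w j eq 1+y+j≡p = +-cancelˡ-≡ (y * q + l) _ _ (begin
      y * q + l + (z * p + w + l + 1)      ≡⟨ solve (y ∷ q ∷ l ∷ z ∷ p ∷ w ∷ []) ⟩
      l + l + 1 + (y * q + z * p + w)      ≡⟨ eq ⟩
      p * q                                ≡⟨ cong (_* q) 1+y+j≡p ⟨
      (suc y + j) * q                      ≡⟨ solve (y ∷ j ∷ q ∷ []) ⟩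
      y * q + suc j * q                    ≡⟨ cong (λ t → y * q + suc j * t) q≡κp+l ⟩
      y * q + suc j * (κ * p + l)          ≡⟨ solve (y ∷ q ∷ l ∷ j ∷ κ ∷ p ∷ []) ⟩
      y * q + l + (suc j * κ * p + j * l)  ∎)
      where open ≡-Reasoning

    few-columns-cost : ∀ y z w j → l + l + 1 + (y * q + z * p + w) ≡ p * q → suc y + j ≡ p →
                       z < suc j * κ → p + p + κ ≤ y + z + w + (l + 4)
    few-columns-cost y z w j eq 1+y+j≡p z<[1+j]κ with m≤n⇒∃[o]m+o≡n z<[1+j]κ
    ... | m , 1+z+m≡[1+j]κ = begin
      p + p + κ                                  ≡⟨ cong (λ t → t + p + κ) 1+y+j≡p ⟨
      suc y + j + p + κ                          ≡⟨ solve (y ∷ j ∷ p ∷ κ ∷ []) ⟩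
      y + p + 1 + (κ + j)                        ≤⟨ +-monoʳ-≤ (y + p + 1) κ+j≤1+z+m ⟩
      y + p + 1 + (suc z + m)                    ≤⟨ +-monoʳ-≤ (y + p + 1) (+-monoʳ-≤ (suc z) (m≤m*n m p)) ⟩
      y + p + 1 + (suc z + m * p)                ≤⟨ m≤m+n _ (suc (j * l)) ⟩
      y + p + 1 + (suc z + m * p) + suc (j * l)  ≡⟨ solve (y ∷ p ∷ z ∷ m ∷ j ∷ l ∷ []) ⟩
      y + z + (p + m * p + j * l) + 3            ≡⟨ cong (λ t → y + z + t + 3) w+l+1≡[1+m]p+jl ⟨
      y + z + (w + l + 1) + 3                    ≡⟨ solve (y ∷ z ∷ w ∷ l ∷ []) ⟩
      y + z + w + (l + 4)                        ∎
      where
      open ≤-Reasoning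
      κ+j≤1+z+m : κ + j ≤ suc z + m
      κ+j≤1+z+m = ≤-trans (+-monoʳ-≤ κ (m≤m*n j κ)) (≤-reflexive (sym 1+z+m≡[1+j]κ))
      w+l+1≡[1+m]p+jl : w + l + 1 ≡ p + m * p + j * l
      w+l+1≡[1+m]p+jl = +-cancelˡ-≡ (z * p) _ _ (begin-equality
        z * p + (w + l + 1)                ≡⟨ solve (z ∷ p ∷ w ∷ l ∷ []) ⟩
        z * p + w + l + 1                  ≡⟨ rows-above y z w j eq 1+y+j≡p ⟩
        suc j * κ * p + j * l              ≡⟨ cong (λ t → t * p + j * l) 1+z+m≡[1+j]κ ⟨
        (suc z + m) * p + j * l            ≡⟨ solve (z ∷ m ∷ p ∷ j ∷ l ∷ []) ⟩
        z * p + (p + m * p + j * l)        ∎)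

    -- Each further column costs p ≥ 2l, more than two extra rows can pay for.
    many-columns-rows : ∀ t w j → t * p + w + l + 1 ≡ j * l → suc (suc (t + t)) ≤ j
    many-columns-rows t w j leftover = *-cancelʳ-< l (suc (t + t)) j (begin-strict
      suc (t + t) * l      ≡⟨ solve (t ∷ l ∷ []) ⟩
      l + t * (l + l)      ≤⟨ +-monoʳ-≤ l (*-monoʳ-≤ t 2l≤p) ⟩
      l + t * p            ≡⟨ +-comm l (t * p) ⟩
      t * p + l            ≤⟨ +-monoˡ-≤ l (m≤m+n (t * p) w) ⟩
      t * p + w + l        <⟨ m<m+n (t * p + w + l) (s≤s z≤n) ⟩
      t * p + w + l + 1    ≡⟨ leftover ⟩
      j * l                ∎)
      where open ≤-Reasoning

    many-columns-cost : ∀ y t w j → suc y + j ≡ p → t * p + w + l + 1 ≡ j * l →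
                        p + p + κ ≤ y + (suc j * κ + t) + w + (l + 4)
    many-columns-cost y t w j 1+y+j≡p leftover with m≤n⇒∃[o]m+o≡n (many-columns-rows t w j leftover)
    ... | m , refl = +-cancelʳ-≤ (t * p) _ _ (begin
      p + p + κ + t * p                                               ≡⟨ cong (λ u → u + p + κ + t * p) 1+y+j≡p ⟨
      suc y + j + p + κ + t * p                                       ≤⟨ n≤1+n _ ⟩
      suc (suc y + j + p + κ + t * p)                                 ≡⟨ solve (y ∷ t ∷ m ∷ p ∷ κ ∷ []) ⟩
      y + κ + (1 + t) * (p + 1) + m + t + 3                           ≤⟨ +-monoˡ-≤ 3 (+-monoˡ-≤ t (+-mono-≤
                                                                           (+-monoʳ-≤ (y + κ) (*-monoʳ-≤ (1 + t) p<2[κ+l]))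
                                                                           (m≤m*n m (κ + l)))) ⟩
      y + κ + (1 + t) * (κ + κ + l + l) + m * (κ + l) + t + 3         ≡⟨ solve (y ∷ κ ∷ t ∷ l ∷ m ∷ []) ⟩
      y + (suc j * κ + t) + j * l + 3                                 ≡⟨ cong (λ u → y + (suc j * κ + t) + u + 3) leftover ⟨
      y + (suc j * κ + t) + (t * p + w + l + 1) + 3                   ≡⟨ solve (y ∷ t ∷ m ∷ κ ∷ p ∷ w ∷ l ∷ []) ⟩
      y + (suc j * κ + t) + w + (l + 4) + t * p                       ∎)
      where open ≤-Reasoning

    one-row-cost : ∀ y z w → l + l + 1 + (y * q + z * p + w) ≡ p * q → y < p → p + p + κ ≤ y + z + w + (l + 4)
    one-row-cost y z w eq y<p with m≤n⇒∃[o]m+o≡n y<p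
    ... | j , 1+y+j≡p with z <? suc j * κ
    ...   | yes z<[1+j]κ = few-columns-cost y z w j eq 1+y+j≡p z<[1+j]κ
    ...   | no  z≮[1+j]κ with m≤n⇒∃[o]m+o≡n (≮⇒≥ z≮[1+j]κ)
    ...     | t , refl = many-columns-cost y t w j 1+y+j≡p (+-cancelˡ-≡ (suc j * κ * p) _ _ (begin
      suc j * κ * p + (t * p + w + l + 1)  ≡⟨ solve (j ∷ κ ∷ p ∷ t ∷ w ∷ l ∷ []) ⟩
      (suc j * κ + t) * p + w + l + 1      ≡⟨ rows-above y (suc j * κ + t) w j eq 1+y+j≡p ⟩
      suc j * κ * p + j * l                ∎))
      where open ≡-Reasoning

    two-row-cost : ∀ y z w → l + l + 1 + (y * q + z * p + w) ≡ p * q + p * q → y < p → z < q →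
                   p + p + κ ≤ w + (l + 3)
    two-row-cost y z w eq y<p z<q = +-cancelʳ-≤ l _ _ (begin
      p + p + κ + l                ≡⟨ solve (p ∷ κ ∷ l ∷ []) ⟩
      p + (p + κ) + l              ≤⟨ +-monoˡ-≤ l (+-monoʳ-≤ p (m+n≤n*m+1 p κ)) ⟩
      p + (κ * p + 1) + l          ≡⟨ solve (p ∷ κ ∷ l ∷ []) ⟩
      p + (κ * p + l) + 1          ≡⟨ cong (λ u → p + u + 1) q≡κp+l ⟨
      p + q + 1                    ≤⟨ +-monoˡ-≤ 1 p+q≤ ⟩
      l + l + 1 + w + 1            ≤⟨ n≤1+n _ ⟩
      suc (l + l + 1 + w + 1)      ≡⟨ solve (l ∷ w ∷ []) ⟩
      w + (l + 3) + l              ∎)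
      where
      open ≤-Reasoning
      m+n≤n*m+1 : ∀ m n .{{_ : NonZero m}} .{{_ : NonZero n}} → m + n ≤ n * m + 1
      m+n≤n*m+1 (suc m) (suc n) = begin
        suc m + suc n              ≡⟨ solve (m ∷ n ∷ []) ⟩
        suc m + n + 1              ≤⟨ +-monoˡ-≤ 1 (+-monoʳ-≤ (suc m) (m≤m*n n (suc m))) ⟩
        suc m + n * suc m + 1      ∎
      p+q≤ : p + q ≤ l + l + 1 + w
      p+q≤ = +-cancelʳ-≤ (p * q + p * q) _ _ (begin
        p + q + (p * q + p * q)                         ≡⟨ cong (λ t → p + q + t) eq ⟨
        p + q + (l + l + 1 + (y * q + z * p + w))       ≡⟨ solve (p ∷ q ∷ l ∷ y ∷ z ∷ w ∷ []) ⟩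
        l + l + 1 + w + (q + y * q) + (p + z * p)       ≤⟨ +-mono-≤ (+-monoʳ-≤ (l + l + 1 + w) (*-monoˡ-≤ q y<p)) (*-monoˡ-≤ p z<q) ⟩
        l + l + 1 + w + p * q + q * p                   ≡⟨ solve (l ∷ w ∷ p ∷ q ∷ []) ⟩
        l + l + 1 + w + (p * q + p * q)                 ∎)

    drop-pq : ∀ s {X X′} → S₀ * (p * q) + l + l + 1 + X ≡ suc s * (p * q) → X ≡ p * q + X′ →
              S₀ * (p * q) + l + l + 1 + X′ ≡ s * (p * q)
    drop-pq s {X′ = X′} eq refl = +-cancelˡ-≡ (p * q) _ _ (begin
      p * q + (A + X′)  ≡⟨ +-assoc (p * q) A X′ ⟨
      p * q + A + X′    ≡⟨ cong (_+ X′) (+-comm (p * q) A) ⟩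
      A + p * q + X′    ≡⟨ +-assoc A (p * q) X′ ⟩
      A + (p * q + X′)  ≡⟨ eq ⟩
      suc s * (p * q)   ∎)
      where
      open ≡-Reasoning
      A = S₀ * (p * q) + l + l + 1

    rows-of-reduced : ∀ s y z w → y < p → z < q → w < p * q →
                      S₀ * (p * q) + (l + l + 1 + (y * q + z * p + w)) ≡ s * (p * q) →
                      s ≡ suc S₀ ⊎ s ≡ 2 + S₀
    rows-of-reduced s y z w y<p z<q w<pq eq = by-cases (m≤n⇒m<n∨m≡n S₀<s)
      where
      open ≤-Reasoning
      X = y * q + z * p + w
      S₀<s : S₀ < s
      S₀<s = *-cancelʳ-< (p * q) S₀ s (begin-strict
        S₀ * (p * q)                            <⟨ m<m+n (S₀ * (p * q)) (≤-trans (m≤n+m 1 (l + l)) (m≤m+n (l + l + 1) X)) ⟩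
        S₀ * (p * q) + (l + l + 1 + X)          ≡⟨ eq ⟩
        s * (p * q)                             ∎)
      X<3pq : l + l + 1 + X < p * q + p * q + p * q
      X<3pq = +-cancelʳ-≤ p _ _ (begin
        suc (l + l + 1 + (y * q + z * p + w)) + p       ≤⟨ m≤m+n _ q ⟩
        suc (l + l + 1 + (y * q + z * p + w)) + p + q   ≡⟨ solve (l ∷ y ∷ z ∷ w ∷ p ∷ q ∷ []) ⟩
        suc (l + l) + (q + y * q) + (p + z * p) + suc w ≤⟨ +-mono-≤ (+-mono-≤ (+-mono-≤ 2l<p (*-monoˡ-≤ q y<p)) (*-monoˡ-≤ p z<q)) w<pq ⟩
        p + p * q + q * p + p * q                       ≡⟨ solve (p ∷ q ∷ []) ⟩
        p * q + p * q + p * q + p                       ∎)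
      s<S₀+3 : s < S₀ + 3
      s<S₀+3 = *-cancelʳ-< (p * q) s (S₀ + 3) (begin-strict
        s * (p * q)                             ≡⟨ eq ⟨
        S₀ * (p * q) + (l + l + 1 + X)          <⟨ +-monoʳ-< (S₀ * (p * q)) X<3pq ⟩
        S₀ * (p * q) + (p * q + p * q + p * q)  ≡⟨ solve (S₀ ∷ p ∷ q ∷ []) ⟩
        (S₀ + 3) * (p * q)                      ∎)
      by-cases : suc S₀ < s ⊎ suc S₀ ≡ s → s ≡ suc S₀ ⊎ s ≡ 2 + S₀
      by-cases (inj₂ 1+S₀≡s) = inj₁ (sym 1+S₀≡s)
      by-cases (inj₁ 2+S₀≤s) = inj₂ (≤-antisym (≤-pred (≤-trans s<S₀+3 (≤-reflexive (+-comm S₀ 3)))) 2+S₀≤s)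

    reduced-cost : ∀ s y z w → y < p → z < q → w < p * q →
                   S₀ * (p * q) + (l + l + 1 + (y * q + z * p + w)) ≡ s * (p * q) → suc s ≤ y + z + w
    reduced-cost s y z w y<p z<q w<pq eq with rows-of-reduced s y z w y<p z<q w<pq eq
    ... | inj₁ refl = +-cancelʳ-≤ (l + 4) _ _ (begin
      2 + S₀ + (l + 4)        ≡⟨ solve (S₀ ∷ l ∷ []) ⟩
      S₀ + l + 6              ≡⟨ S₀+l+6≡budget ⟩
      p + p + κ               ≤⟨ one-row-cost y z w (+-cancelˡ-≡ (S₀ * (p * q)) _ _ (trans eq (+-comm (p * q) (S₀ * (p * q))))) y<p ⟩
      y + z + w + (l + 4)     ∎)
      where open ≤-Reasoning
    ... | inj₂ refl = +-cancelʳ-≤ (l + 3) _ _ (begin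
      3 + S₀ + (l + 3)        ≡⟨ solve (S₀ ∷ l ∷ []) ⟩
      S₀ + l + 6              ≡⟨ S₀+l+6≡budget ⟩
      p + p + κ               ≤⟨ two-row-cost y z w (+-cancelˡ-≡ (S₀ * (p * q)) _ _ (trans eq (solve (S₀ ∷ p ∷ q ∷ [])))) y<p z<q ⟩
      w + (l + 3)             ≤⟨ +-monoˡ-≤ (l + 3) (m≤n+m w (y + z)) ⟩
      y + z + w + (l + 3)     ∎)
      where open ≤-Reasoning

    cost-lower-bound : ∀ s y z w → S₀ * (p * q) + l + l + 1 + (y * q + z * p + w) ≡ s * (p * q) → suc s ≤ y + z + w
    cost-lower-bound zero y z w eq = contradiction (m+n≡0⇒m≡0 _ eq) (m+1+n≢0 (S₀ * (p * q) + l + l))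
    cost-lower-bound (suc s) y z w eq with p ≤? y | q ≤? z | p * q ≤? w
    ... | yes p≤y | _ | _ with m≤n⇒∃[o]m+o≡n p≤y
    ...   | y′ , refl = begin
      2 + s             ≤⟨ +-mono-≤ (>-nonZero⁻¹ p) (cost-lower-bound s y′ z w (drop-pq s eq (solve (p ∷ q ∷ y′ ∷ z ∷ w ∷ [])))) ⟩
      p + (y′ + z + w)  ≡⟨ solve (p ∷ y′ ∷ z ∷ w ∷ []) ⟩
      p + y′ + z + w    ∎
      where open ≤-Reasoning
    cost-lower-bound (suc s) y z w eq | no _ | yes q≤z | _ with m≤n⇒∃[o]m+o≡n q≤z
    ...   | z′ , refl = begin
      2 + s             ≤⟨ +-mono-≤ (>-nonZero⁻¹ q) (cost-lower-bound s y z′ w (drop-pq s eq (solve (p ∷ q ∷ y ∷ z′ ∷ w ∷ [])))) ⟩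
      q + (y + z′ + w)  ≡⟨ solve (q ∷ y ∷ z′ ∷ w ∷ []) ⟩
      y + (q + z′) + w  ∎
      where open ≤-Reasoning
    cost-lower-bound (suc s) y z w eq | no _ | no _ | yes pq≤w with m≤n⇒∃[o]m+o≡n pq≤w
    ...   | w′ , refl = begin
      2 + s                   ≤⟨ +-mono-≤ (>-nonZero⁻¹ (p * q)) (cost-lower-bound s y z w′ (drop-pq s eq (solve (p ∷ q ∷ y ∷ z ∷ w′ ∷ [])))) ⟩
      p * q + (y + z + w′)    ≡⟨ solve (p ∷ q ∷ y ∷ z ∷ w′ ∷ []) ⟩
      y + z + (p * q + w′)    ∎
      where open ≤-Reasoning
    cost-lower-bound (suc s) y z w eq | no p≰y | no q≰z | no pq≰w =
      reduced-cost (suc s) y z w (≰⇒> p≰y) (≰⇒> q≰z) (≰⇒> pq≰w) (trans (regroup (S₀ * (p * q)) l (y * q + z * p + w)) eq)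
      where
      regroup : ∀ a b c → a + (b + b + 1 + c) ≡ a + b + b + 1 + c
      regroup = solve-∀

-- The parameters κ, τ and λ′

κ-positive : ∀ {p q κ l} → q ≡ κ * p + l → l < p → p < q → 1 ≤ κ
κ-positive {κ = zero}  refl l<p p<l = contradiction (<-trans l<p p<l) (<-irrefl refl)
κ-positive {κ = suc _} _    _   _   = s≤s z≤n

τ-zero : ∀ {p κ l τ} → 1 ≤ κ → κ + l ≤ p ∸ l → τ * (p ∸ l) ≤ l → τ ≡ 0
τ-zero {τ = zero} _ _ _ = refl
τ-zero {p} {κ} {l} {suc τ} 1≤κ κ+l≤p∸l [1+τ][p∸l]≤l = contradiction (begin-strict
  l                      <⟨ m<n+m l 1≤κ ⟩
  κ + l                  ≤⟨ κ+l≤p∸l ⟩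
  p ∸ l                  ≤⟨ m≤m+n (p ∸ l) (τ * (p ∸ l)) ⟩
  suc τ * (p ∸ l)        ≤⟨ [1+τ][p∸l]≤l ⟩
  l                      ∎) (<-irrefl refl)
  where open ≤-Reasoning

-- Both sides write q as a multiple of 2P plus a remainder: 2λ′ + 1 via
-- q′ = κ′p′ + λ′, and κ + l via q = κp + l.
κ+l≡2λ′+1 : ∀ {P Q κ l κ′ λ′} → suc (Q + Q) ≡ κ * suc (P + P) + l → Q ≡ κ′ * P + λ′ →
            λ′ < P → κ + l ≤ P + P → κ + l ≡ suc (λ′ + λ′)
κ+l≡2λ′+1 {P} {Q} {κ} {l} {κ′} {λ′} q≡κp+l Q≡κ′P+λ′ λ′<P κ+l≤2P = by-cases (m≤n⇒m<n∨m≡n κ+l≤2P)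
  where
  open ≡-Reasoning
  instance
    2P-nonZero : NonZero (P + P)
    2P-nonZero = >-nonZero (≤-trans (s≤s z≤n) (≤-trans λ′<P (m≤m+n P P)))
  2λ′+1<2P : suc (λ′ + λ′) < P + P
  2λ′+1<2P = ≤-trans (s≤s (≤-reflexive (sym (+-suc λ′ λ′)))) (+-mono-≤ λ′<P λ′<P)
  same-residue : suc (λ′ + λ′) % (P + P) ≡ (κ + l) % (P + P)
  same-residue = begin
    suc (λ′ + λ′) % (P + P)                     ≡⟨ [m+kn]%n≡m%n (suc (λ′ + λ′)) κ′ (P + P) ⟨
    (suc (λ′ + λ′) + κ′ * (P + P)) % (P + P)    ≡⟨ cong (_% (P + P)) two-divisions ⟩
    (κ + l + κ * (P + P)) % (P + P)             ≡⟨ [m+kn]%n≡m%n (κ + l) κ (P + P) ⟩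
    (κ + l) % (P + P)                           ∎
    where
    two-divisions : suc (λ′ + λ′) + κ′ * (P + P) ≡ κ + l + κ * (P + P)
    two-divisions = begin
      suc (λ′ + λ′) + κ′ * (P + P)              ≡⟨ solve (λ′ ∷ κ′ ∷ P ∷ []) ⟩
      suc ((κ′ * P + λ′) + (κ′ * P + λ′))       ≡⟨ cong (λ t → suc (t + t)) Q≡κ′P+λ′ ⟨
      suc (Q + Q)                               ≡⟨ q≡κp+l ⟩
      κ * suc (P + P) + l                       ≡⟨ solve (κ ∷ P ∷ l ∷ []) ⟩
      κ + l + κ * (P + P)                       ∎
  by-cases : κ + l < P + P ⊎ κ + l ≡ P + P → κ + l ≡ suc (λ′ + λ′)
  by-cases (inj₁ κ+l<2P) = begin
    κ + l                      ≡⟨ m<n⇒m%n≡m κ+l<2P ⟨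
    (κ + l) % (P + P)          ≡⟨ same-residue ⟨
    suc (λ′ + λ′) % (P + P)    ≡⟨ m<n⇒m%n≡m 2λ′+1<2P ⟩
    suc (λ′ + λ′)              ∎
  by-cases (inj₂ κ+l≡2P) = contradiction (begin
    0                          ≡⟨ n%n≡0 (P + P) ⟨
    (P + P) % (P + P)          ≡⟨ cong (_% (P + P)) κ+l≡2P ⟨
    (κ + l) % (P + P)          ≡⟨ same-residue ⟨
    suc (λ′ + λ′) % (P + P)    ≡⟨ m<n⇒m%n≡m 2λ′+1<2P ⟩
    suc (λ′ + λ′)              ∎) λ ()

typeII⇒p<2[κ+l] : ∀ {P κ l λ′} → κ + l ≡ suc (λ′ + λ′) → TypeII (suc (P + P)) λ′ 0 → suc (P + P) + 1 ≤ κ + κ + l + l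
typeII⇒p<2[κ+l] {P} {κ} {l} {λ′} κ+l≡2λ′+1 typeII = begin
  suc (P + P) + 1                        ≡⟨ +-comm (suc (P + P)) 1 ⟩
  suc (suc (P + P))                      ≤⟨ s≤s (s≤s (+-mono-≤ P≤2λ′ P≤2λ′)) ⟩
  suc (suc ((λ′ + λ′) + (λ′ + λ′)))      ≡⟨ solve (λ′ ∷ []) ⟩
  suc (λ′ + λ′) + suc (λ′ + λ′)          ≡⟨ cong (λ t → t + t) κ+l≡2λ′+1 ⟨
  (κ + l) + (κ + l)                      ≡⟨ solve (κ ∷ l ∷ []) ⟩
  κ + κ + l + l                          ∎
  where
  open ≤-Reasoning
  P≤2λ′ : P ≤ λ′ + λ′
  P≤2λ′ = subst₂ _≤_ (trans (*-identityʳ _) (half-pred-odd P)) (cong (λ t → λ′ + t) (+-identityʳ λ′)) typeII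

typeI⇒κ+l≤P : ∀ {P κ l λ′} → κ + l ≡ suc (λ′ + λ′) → TypeI (suc (P + P)) λ′ 0 → κ + l ≤ P
typeI⇒κ+l≤P {P} {κ} {l} {λ′} κ+l≡2λ′+1 typeI =
  subst₂ _≤_ (sym (trans κ+l≡2λ′+1 (cong (λ t → suc (λ′ + t)) (sym (+-identityʳ λ′)))))
             (trans (*-identityʳ _) (half-pred-odd P)) typeI

-- The number g₁

g₁≡ : ∀ p q κ l → g₁ p q κ l ≡
  + ((half-pred p ∸ 1) * d₀ p q + (p ∸ 1) * d₁ p q + κ * d₂ p q) ℤ.- + (suc l * d₃ p q)
g₁≡ p q κ l = trans (regroup (+ a) (+ D₀) (+ b) (+ D₁) (+ κ) (+ D₂) (+ D₃) (+ l)) (cong₂ ℤ._-_ (sym positive) (sym negative))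
  where
  a = half-pred p ∸ 1
  b = p ∸ 1
  D₀ = d₀ p q
  D₁ = d₁ p q
  D₂ = d₂ p q
  D₃ = d₃ p q
  regroup : ∀ a D₀ b D₁ k D₂ D₃ m →
    a ℤ.* D₀ ℤ.+ b ℤ.* D₁ ℤ.+ k ℤ.* D₂ ℤ.+ ℤ.- (+ 1) ℤ.* D₃ ℤ.- m ℤ.* D₃ ≡
    (a ℤ.* D₀ ℤ.+ b ℤ.* D₁ ℤ.+ k ℤ.* D₂) ℤ.- (D₃ ℤ.+ m ℤ.* D₃)
  regroup = ℤ-Solver.solve-∀
  positive : + (a * D₀ + b * D₁ + κ * D₂) ≡ + a ℤ.* + D₀ ℤ.+ + b ℤ.* + D₁ ℤ.+ + κ ℤ.* + D₂
  positive = trans (ℤ.pos-+ (a * D₀ + b * D₁) (κ * D₂))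
    (cong₂ ℤ._+_ (trans (ℤ.pos-+ (a * D₀) (b * D₁)) (cong₂ ℤ._+_ (ℤ.pos-* a D₀) (ℤ.pos-* b D₁))) (ℤ.pos-* κ D₂))
  negative : + (suc l * D₃) ≡ + D₃ ℤ.+ + l ℤ.* + D₃
  negative = trans (ℤ.pos-+ D₃ (l * D₃)) (cong (λ t → + D₃ ℤ.+ t) (ℤ.pos-* l D₃))

twice-positive-part : ∀ P₁ Q κ l S₀ →
  let P = suc P₁; p = suc (P + P); q = suc (Q + Q); N = p * q
      A = P₁ * N + (P + P) * (P * q) + κ * (p * Q)
      B = suc l * (P * Q + P * Q + P + Q)
  in A + A + (κ * p + l) + (S₀ + l + 6) * N ≡ S₀ * N + l + l + 1 + (B + B) + (q + (p + p + κ) * N)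
twice-positive-part = solve-∀

witness-rows : ∀ {p q κ l} y w → q ≡ κ * p + l → suc w ≡ l → l + l + 1 + (y * q + 3 * κ * p + w) ≡ (y + 3) * q
witness-rows {p} {q} {κ} {l} y w q≡κp+l 1+w≡l = begin
  l + l + 1 + (y * q + 3 * κ * p + w)              ≡⟨ cong (λ t → t + t + 1 + (y * q + 3 * κ * p + w)) 1+w≡l ⟨
  suc w + suc w + 1 + (y * q + 3 * κ * p + w)      ≡⟨ solve (w ∷ y ∷ q ∷ κ ∷ p ∷ []) ⟩
  y * q + 3 * (κ * p + suc w)                      ≡⟨ cong (λ t → y * q + 3 * (κ * p + t)) 1+w≡l ⟩
  y * q + 3 * (κ * p + l)                          ≡⟨ cong (λ t → y * q + 3 * t) q≡κp+l ⟨
  y * q + 3 * q                                    ≡⟨ solve (y ∷ q ∷ []) ⟩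
  (y + 3) * q                                      ∎
  where open ≡-Reasoning

witness-count : ∀ {S₀ P₁ κ l X} w → S₀ + l + 6 ≡ suc (suc P₁ + suc P₁) + suc (suc P₁ + suc P₁) + κ →
                suc P₁ ≡ κ + l + X → suc w ≡ l → suc S₀ ≡ X + X + (P₁ + P₁) + 3 * κ + w
witness-count {S₀} {P₁} {κ} {l} {X} w S₀+l+6≡budget P≡κ+l+X 1+w≡l = +-cancelʳ-≡ (l + 6) _ _ (begin
  suc S₀ + (l + 6)                                          ≡⟨ solve (S₀ ∷ l ∷ []) ⟩
  suc (S₀ + l + 6)                                          ≡⟨ cong suc S₀+l+6≡budget ⟩
  suc (suc (suc P₁ + suc P₁) + suc (suc P₁ + suc P₁) + κ)   ≡⟨ solve (P₁ ∷ κ ∷ []) ⟩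
  P₁ + P₁ + (suc P₁ + suc P₁) + κ + 5                       ≡⟨ cong (λ t → P₁ + P₁ + (t + t) + κ + 5) P≡κ+l+X ⟩
  P₁ + P₁ + ((κ + l + X) + (κ + l + X)) + κ + 5             ≡⟨ cong (λ t → P₁ + P₁ + ((κ + t + X) + (κ + l + X)) + κ + 5) 1+w≡l ⟨
  P₁ + P₁ + ((κ + suc w + X) + (κ + l + X)) + κ + 5         ≡⟨ solve (P₁ ∷ κ ∷ w ∷ l ∷ X ∷ []) ⟩
  X + X + (P₁ + P₁) + 3 * κ + w + (l + 6)                   ∎)
  where open ≡-Reasoning

module Frobenius (P₁ Q κ l : ℕ) (q≡κp+l : suc (Q + Q) ≡ κ * suc (suc P₁ + suc P₁) + l)
                 (1≤κ : 1 ≤ κ) (1≤l : 1 ≤ l) (κ+2l≤p : κ + l + l ≤ suc (suc P₁ + suc P₁)) where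
  private
    P = suc P₁
    p = suc (P + P)
    q = suc (Q + Q)

  l+6≤budget : l + 6 ≤ p + p + κ
  l+6≤budget = begin
    l + 6                                  ≤⟨ +-monoʳ-≤ l (+-mono-≤ (+-mono-≤ 2≤κ+l 2≤κ+l) 2≤κ+l) ⟩
    l + ((κ + l) + (κ + l) + (κ + l))      ≡⟨ solve (κ ∷ l ∷ []) ⟩
    (κ + l + l) + (κ + l + l) + κ          ≤⟨ +-monoˡ-≤ κ (+-mono-≤ κ+2l≤p κ+2l≤p) ⟩
    p + p + κ                              ∎
    where
    open ≤-Reasoning
    2≤κ+l : 2 ≤ κ + l
    2≤κ+l = +-mono-≤ 1≤κ 1≤l

  S₀ : ℕ
  S₀ = p + p + κ ∸ (l + 6)

  S₀+l+6≡budget : S₀ + l + 6 ≡ p + p + κ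
  S₀+l+6≡budget = trans (+-assoc S₀ l 6) (m∸n+n≡m l+6≤budget)

  open Budget p q κ l q≡κp+l 1≤κ 1≤l κ+2l≤p S₀ S₀+l+6≡budget using (cheap-complement; module LowerBound)

  A B : ℕ
  A = P₁ * (p * q) + (P + P) * (P * q) + κ * (p * Q)
  B = suc l * (P * Q + P * Q + P + Q)

  twice-A : A + A ≡ S₀ * (p * q) + l + l + 1 + (B + B)
  twice-A = +-cancelʳ-≡ (q + (p + p + κ) * (p * q)) _ _ (begin
    A + A + (q + (p + p + κ) * (p * q))                               ≡⟨ cong₂ (λ u v → A + A + (u + v * (p * q))) q≡κp+l (sym S₀+l+6≡budget) ⟩
    A + A + (κ * p + l + (S₀ + l + 6) * (p * q))                      ≡⟨ +-assoc (A + A) (κ * p + l) _ ⟨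
    A + A + (κ * p + l) + (S₀ + l + 6) * (p * q)                      ≡⟨ twice-positive-part P₁ Q κ l S₀ ⟩
    S₀ * (p * q) + l + l + 1 + (B + B) + (q + (p + p + κ) * (p * q))  ∎)
    where open ≡-Reasoning

  B≤A : B ≤ A
  B≤A = double-cancel-≤ (≤-trans (m≤n+m (B + B) (S₀ * (p * q) + l + l + 1)) (≤-reflexive (sym twice-A)))

  g : ℕ
  g = A ∸ B

  g+g : g + g ≡ S₀ * (p * q) + l + l + 1
  g+g = +-cancelʳ-≡ (B + B) _ _ (begin
    g + g + (B + B)                     ≡⟨ shuffle g B ⟩
    (g + B) + (g + B)                   ≡⟨ cong (λ t → t + t) (m∸n+n≡m B≤A) ⟩
    A + A                               ≡⟨ twice-A ⟩
    S₀ * (p * q) + l + l + 1 + (B + B)  ∎)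
    where
    open ≡-Reasoning
    shuffle : ∀ a b → a + a + (b + b) ≡ (a + b) + (a + b)
    shuffle = solve-∀

  g≡g₁ : + g ≡ g₁ p q κ l
  g≡g₁ = sym (begin
    g₁ p q κ l                                    ≡⟨ g₁≡ p q κ l ⟩
    + ((half-pred p ∸ 1) * d₀ p q + (p ∸ 1) * d₁ p q + κ * d₂ p q) ℤ.- + (suc l * d₃ p q)
                                                  ≡⟨ cong₂ (λ a b → + a ℤ.- + b) positive-part negative-part ⟩
    + A ℤ.- + B                                   ≡⟨ ℤ.m-n≡m⊖n A B ⟩
    A ℤ.⊖ B                                       ≡⟨ ℤ.⊖-≥ B≤A ⟩
    + g                                           ∎)
    where
    open ≡-Reasoning
    positive-part : (half-pred p ∸ 1) * d₀ p q + (p ∸ 1) * d₁ p q + κ * d₂ p q ≡ A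
    positive-part rewrite half-pred-odd P | half-pred-odd Q = refl
    negative-part : suc l * d₃ p q ≡ B
    negative-part = cong (λ t → suc l * t) (d₃-odd P Q)

  0<g : 0 < g
  0<g = n≢0⇒n>0 λ g≡0 → m+1+n≢0 (S₀ * (p * q) + l + l) (trans (sym g+g) (cong (λ t → t + t) g≡0))

  representable-above-g : ∀ n → g < n → Representable p q n
  representable-above-g n g<n =
    let a , y , z , w , eq , cost≤1+a = cheap-complement (n + n) threshold≤2n
    in Equivalence.from (representable⇔doubly P Q n) (cost≤⇒doubly P Q n a y z w eq cost≤1+a)
    where
    threshold≤2n : S₀ * (p * q) + l + l + 3 ≤ n + n
    threshold≤2n = begin
      S₀ * (p * q) + l + l + 3        ≡⟨ +-assoc (S₀ * (p * q) + l + l) 1 2 ⟨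
      S₀ * (p * q) + l + l + 1 + 2    ≡⟨ cong (_+ 2) g+g ⟨
      g + g + 2                       ≡⟨ trans (+-comm (g + g) 2) (cong suc (sym (+-suc g g))) ⟩
      suc g + suc g                   ≤⟨ +-mono-≤ g<n g<n ⟩
      n + n                           ∎
      where open ≤-Reasoning

  g-not-representable : p + 1 ≤ κ + κ + l + l → ¬ Representable p q g
  g-not-representable p<2[κ+l] rep =
    let x , y , z , w , eq = Equivalence.to (representable⇔doubly P Q g) rep
    in contradiction (cost-lower-bound (x + x + y + z + w) y z w (trans (cong (_+ (y * q + z * p + w)) (sym g+g)) eq))
                     (≤⇒≯ (cost≤ x y z w))
    where
    open LowerBound p<2[κ+l] using (cost-lower-bound)
    cost≤ : ∀ x y z w → y + z + w ≤ x + x + y + z + w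
    cost≤ x y z w = begin
      y + z + w               ≤⟨ m≤n+m (y + z + w) (x + x) ⟩
      x + x + (y + z + w)     ≡⟨ solve (x ∷ y ∷ z ∷ w ∷ []) ⟩
      x + x + y + z + w       ∎
      where open ≤-Reasoning

  g-representable : κ + l ≤ P → Representable p q g
  g-representable κ+l≤P =
    let X , κ+l+X≡P = m≤n⇒∃[o]m+o≡n κ+l≤P
        w , 1+w≡l   = m≤n⇒∃[o]m+o≡n 1≤l
    in Equivalence.from (representable⇔doubly P Q g) (X , P₁ + P₁ , 3 * κ , w , doubled X w κ+l+X≡P 1+w≡l)
    where
    open ≡-Reasoning
    regroup : ∀ a b c → a + b + b + 1 + c ≡ a + (b + b + 1 + c)
    regroup = solve-∀
    2P₁+3≡p : P₁ + P₁ + 3 ≡ suc (suc P₁ + suc P₁)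
    2P₁+3≡p = solve (P₁ ∷ [])
    doubled : ∀ X w → κ + l + X ≡ P → suc w ≡ l →
              g + g + ((P₁ + P₁) * q + 3 * κ * p + w) ≡ (X + X + (P₁ + P₁) + 3 * κ + w) * (p * q)
    doubled X w κ+l+X≡P 1+w≡l = begin
      g + g + ((P₁ + P₁) * q + 3 * κ * p + w)                       ≡⟨ cong (_+ ((P₁ + P₁) * q + 3 * κ * p + w)) g+g ⟩
      S₀ * (p * q) + l + l + 1 + ((P₁ + P₁) * q + 3 * κ * p + w)    ≡⟨ regroup (S₀ * (p * q)) l ((P₁ + P₁) * q + 3 * κ * p + w) ⟩
      S₀ * (p * q) + (l + l + 1 + ((P₁ + P₁) * q + 3 * κ * p + w))  ≡⟨ cong (λ t → S₀ * (p * q) + t) (witness-rows {p} {q} {κ} {l} (P₁ + P₁) w q≡κp+l 1+w≡l) ⟩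
      S₀ * (p * q) + (P₁ + P₁ + 3) * q                              ≡⟨ cong (λ t → S₀ * (p * q) + t * q) 2P₁+3≡p ⟩
      S₀ * (p * q) + p * q                                          ≡⟨ +-comm (S₀ * (p * q)) (p * q) ⟩
      suc S₀ * (p * q)                                              ≡⟨ cong (_* (p * q)) (witness-count {S₀} {P₁} {κ} {l} {X} w S₀+l+6≡budget (sym κ+l+X≡P) 1+w≡l) ⟩
      (X + X + (P₁ + P₁) + 3 * κ + w) * (p * q)                     ∎

  generators≥2 : 2 ≤ d₀ p q × 2 ≤ d₁ p q × 2 ≤ d₂ p q × 2 ≤ d₃ p q
  generators≥2 =
    ≤-trans 2≤p (m≤m*n p q) ,
    subst (λ t → 2 ≤ t * q) (sym (half-pred-odd P)) (≤-trans 2≤q (m≤m+n q (P₁ * q))) ,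
    subst (λ t → 2 ≤ p * t) (sym (half-pred-odd Q)) (≤-trans 2≤p (m≤m*n p Q)) ,
    subst (2 ≤_) (sym (d₃-odd P Q)) (≤-trans (+-mono-≤ (s≤s z≤n) 1≤Q) (+-monoˡ-≤ Q (m≤n+m P (P * Q + P * Q))))
    where
    2≤p : 2 ≤ p
    2≤p = s≤s (s≤s z≤n)
    1≤Q : 1 ≤ Q
    1≤Q = n≢0⇒n>0 λ Q≡0 → >⇒≢ 1<κp+l (trans (sym q≡κp+l) (cong (λ t → suc (t + t)) Q≡0))
      where
      1<κp+l : 1 < κ * p + l
      1<κp+l = ≤-trans 2≤p (≤-trans (m≤n*m p κ ⦃ >-nonZero 1≤κ ⦄) (m≤m+n (κ * p) l))
    2≤q : 2 ≤ q
    2≤q = s≤s (≤-trans 1≤Q (m≤m+n Q Q))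
    instance
      Q-nonZero : NonZero Q
      Q-nonZero = >-nonZero 1≤Q

  frobenius-below-g : κ + l ≤ P → ∃[ g′ ] IsFrobeniusNumber p q g′ × g′ < g
  frobenius-below-g κ+l≤P =
    let 2≤d₀ , 2≤d₁ , 2≤d₂ , 2≤d₃ = generators≥2
        g′ , 0<g′ , ¬rep , rep> , g′<g =
          greatest-non-member (representable? p q 2≤d₀ 2≤d₁ 2≤d₂ 2≤d₃) (1-not-representable p q 2≤d₀ 2≤d₁ 2≤d₂ 2≤d₃)
                              g representable-from-g
    in g′ , (0<g′ , ¬rep , rep>) , g′<g
    where
    representable-from-g : ∀ n → g ≤ n → Representable p q n
    representable-from-g n g≤n with m≤n⇒m<n∨m≡n g≤n
    ... | inj₁ g<n  = representable-above-g n g<n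
    ... | inj₂ refl = g-representable κ+l≤P

corollary7p4 :
    (p q : ℕ) → Prime p → Prime q → 2 < p → p < q →
    (κ l κ′ λ′ τ : ℕ) →
    q ≡ κ * p + l → 1 ≤ l → l ≤ p ∸ 1 →
    half-pred q ≡ κ′ * half-pred p + λ′ → λ′ ≤ half-pred p ∸ 1 →
    τ * (p ∸ l) ≤ l → l < (τ + 1) * (p ∸ l) →
    κ + l ≤ p ∸ l →
    (TypeII p λ′ τ → ∃[ g ] (IsFrobeniusNumber p q g × (+ g ≡ g₁ p q κ l)))
    × (TypeI p λ′ τ → ∃[ g ] (IsFrobeniusNumber p q g × (+ g ℤ.< g₁ p q κ l)))
corollary7p4 p q p-prime q-prime 2<p p<q κ l κ′ λ′ τ q≡κp+l 1≤l l≤p∸1 q′≡κ′p′+λ′ λ′≤p′∸1 τ[p∸l]≤l _ κ+l≤p∸l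
  with odd-prime p-prime 2<p | odd-prime q-prime (<-trans 2<p p<q)
... | zero , refl | _ = contradiction 2<p λ { (s≤s ()) }
... | suc P₁ , refl | Q , refl = type-II , type-I
  where
  P = suc P₁
  1≤κ : 1 ≤ κ
  1≤κ = κ-positive q≡κp+l (s≤s l≤p∸1) p<q
  κ+2l≤p : κ + l + l ≤ p
  κ+2l≤p = ≤-trans (+-monoˡ-≤ l κ+l≤p∸l) (≤-reflexive (m∸n+n≡m (m≤n⇒m≤1+n l≤p∸1)))
  κ+l-odd : κ + l ≡ suc (λ′ + λ′)
  κ+l-odd = κ+l≡2λ′+1 {P} {Q} {κ} {l} {κ′} {λ′} q≡κp+l
    (trans (sym (half-pred-odd Q)) (trans q′≡κ′p′+λ′ (cong (λ t → κ′ * t + λ′) (half-pred-odd P))))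
    (s≤s (subst (λ t → λ′ ≤ t ∸ 1) (half-pred-odd P) λ′≤p′∸1))
    (≤-pred (≤-trans (≤-reflexive (+-comm 1 (κ + l))) (≤-trans (+-monoʳ-≤ (κ + l) 1≤l) κ+2l≤p)))
  τ≡0 : τ ≡ 0
  τ≡0 = τ-zero 1≤κ κ+l≤p∸l τ[p∸l]≤l
  open Frobenius P₁ Q κ l q≡κp+l 1≤κ 1≤l κ+2l≤p
  type-II : TypeII p λ′ τ → ∃[ g ] (IsFrobeniusNumber p q g × (+ g ≡ g₁ p q κ l))
  type-II typeII = g , (0<g , g-not-representable p<2[κ+l] , representable-above-g) , g≡g₁
    where p<2[κ+l] = typeII⇒p<2[κ+l] {P} {κ} {l} {λ′} κ+l-odd (subst (TypeII p λ′) τ≡0 typeII)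
  type-I : TypeI p λ′ τ → ∃[ g ] (IsFrobeniusNumber p q g × (+ g ℤ.< g₁ p q κ l))
  type-I typeI =
    let g′ , frobenius , g′<g = frobenius-below-g (typeI⇒κ+l≤P {P} {κ} {l} {λ′} κ+l-odd (subst (TypeI p λ′) τ≡0 typeI))
    in g′ , frobenius , subst (+ g′ ℤ.<_) g≡g₁ (ℤ.+<+ g′<g)
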